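{- For $n\ge 1$ let $Q_n$ be the lattice of order ideals of the shifted staircase poset $\{(i,j):1\le i\le j\le n\}$ (componentwise order). Then \[d(Q_n)=\frac{2n(2n+1)}{3}\binom{2n-1}{n},\] and consequently $d(Q_n)\sim \frac{2}{3\sqrt{\pi}}\,4^n n^{3/2}$ as $n\to\infty$.
   Context: For a finite connected graph $G=(V,E)$, with $d(p,q)$ the graph distance, the Wiener index is $d(G)=\sum_{(p,q)\in V\times V} d(p,q)$ (ordered pairs). For a finite poset $P$, $d(P)$ is the Wiener index of the Hasse diagram of $P$. Order ideals are ordered by inclusion. -}

module Defs where

open import Data.Nat using (ℕ; zero; suc; _≤_)
open import Data.Nat.ListAction using (sum)
open import Data.Bool using (Bool; true)
open import Data.Fin using (Fin) renaming (_≤_ to _≤ᶠ_)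
open import Data.Vec using (Vec; lookup)
open import Data.List using (List; map)
open import Data.Product using (_×_)
open import Data.Sum using (_⊎_)
open import Relation.Nullary using (¬_)
open import Relation.Binary.PropositionalEquality using (_≡_)

-- A subset of [n] × [n] (0-based indices), given by its characteristic matrix.
Mat : ℕ → Set
Mat n = Vec (Vec Bool n) n

_∋[_,_] : ∀ {n} → Mat n → Fin n → Fin n → Set
M ∋[ i , j ] = lookup (lookup M i) j ≡ true

IsIdeal : ∀ {n} → Mat n → Set
IsIdeal {n} M =
  (∀ (i j : Fin n) → M ∋[ i , j ] → i ≤ᶠ j) ×
  (∀ (i j i′ j′ : Fin n) → M ∋[ i , j ] → i′ ≤ᶠ j′ → i′ ≤ᶠ i → j′ ≤ᶠ j → M ∋[ i′ , j′ ])

_⊆_ : ∀ {n} → Mat n → Mat n → Set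
_⊆_ {n} M N = ∀ (i j : Fin n) → M ∋[ i , j ] → N ∋[ i , j ]

_⊂_ : ∀ {n} → Mat n → Mat n → Set
M ⊂ N = (M ⊆ N) × ¬ (N ⊆ M)

Covers : ∀ {n} → Mat n → Mat n → Set
Covers {n} I J = IsIdeal I × IsIdeal J × I ⊂ J ×
  (∀ (K : Mat n) → IsIdeal K → I ⊂ K → ¬ (K ⊂ J))

Adj : ∀ {n} → Mat n → Mat n → Set
Adj I J = Covers I J ⊎ Covers J I

data Walk {n : ℕ} : Mat n → Mat n → ℕ → Set where
  here : ∀ {p} → Walk p p 0
  step : ∀ {p q r k} → Adj p q → Walk q r k → Walk p r (suc k)

IsDist : ∀ {n} → Mat n → Mat n → ℕ → Set
IsDist p q d = Walk p q d × (∀ k → Walk p q k → d ≤ k)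

-- Wiener index over ordered pairs of a vertex list with a distance function.
wiener : ∀ {A : Set} → List A → (A → A → ℕ) → ℕ
wiener vs dist = sum (map (λ p → sum (map (dist p) vs)) vs)

{-# OPTIONS --safe #-}
-- The order ideals of the shifted staircase are determined by their diagonal lengths
-- r₀ ≥ r₁ ≥ ⋯, which drop by at most one at each step and vanish from n on; recording
-- the drops gives a bijection with the bit strings c of length n, under which r_k is the
-- number of ones of c from position k on.  Adjacent ideals differ in exactly one cell,
-- and a path through the meet shows that the graph distance of two ideals is the size of
-- the symmetric difference of their cell sets, that is Σ_k |r_k − r′_k|.  Summing over
-- all pairs of bit strings and splitting off the first bit gives W(n+1) = H(n+1) + 4W(n)
-- for H(n) = Σ |weight c − weight c′|, and H(n+1) = 4H(n) + 2C(2n,n), because pairs of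
-- strings of equal weight are counted by C(2n,n) after complementing one of them.
-- Hence H(n) = n·C(2n,n) and 3W(n) = n(2n+1)·C(2n,n).

module Submission where

open import Defs
open import Data.Nat using (ℕ; zero; suc; _+_; _*_; _∸_; _≤_; _<_; z≤n; s≤s; z<s; s<s; s<s⁻¹; _≟_; _≤?_; _<?_; ∣_-_∣)
open import Data.Nat.Properties
open import Data.Nat.ListAction using (sum)
open import Data.Nat.ListAction.Properties using (sum-++; sum-↭)
open import Data.Nat.Combinatorics using (_C_; nCk+nC[k+1]≡[n+1]C[k+1]; nCk≡nC[n∸k]; nC1≡n)
open import Data.Nat.Tactic.RingSolver using (solve-∀)
open import Algebra.Properties.CommutativeSemigroup +-commutativeSemigroup using (interchange)
open import Algebra.Properties.CommutativeSemigroup *-commutativeSemigroup using (x∙yz≈y∙xz)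
open import Data.Bool using (Bool; true; false; not; _∧_; _∨_; _xor_)
open import Data.Bool.Properties
  using (xor-identityʳ; xor-same; xor-comm; ∨-zeroʳ; ∨-identityʳ; ∧-conicalˡ; ∧-conicalʳ; ¬-not)
  renaming (_≟_ to _≟ᵇ_)
open import Data.Fin using (Fin; toℕ; fromℕ<) renaming (zero to fzero; suc to fsuc)
open import Data.Fin.Properties using (toℕ-fromℕ<)
open import Data.Vec using (Vec; []; _∷_; lookup; tabulate)
open import Data.List using (List; []; _∷_; _++_; map; length; drop; applyUpTo)
open import Data.List.Properties using (map-cong; map-++; map-∘; length-drop; length-applyUpTo; ∷-injectiveʳ)
open import Data.List.Membership.Propositional using (_∈_)
open import Data.List.Membership.Propositional.Properties using (∈-map⁺; ∈-map⁻; ∈-++⁺ˡ; ∈-++⁺ʳ; ∈-++⁻)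
open import Data.List.Membership.Propositional.Properties.WithK using (unique∧set⇒bag)
open import Data.List.Relation.Unary.Any using (here; there)
import Data.List.Relation.Unary.All as All
import Data.List.Relation.Unary.All.Properties as All
open import Data.List.Relation.Unary.AllPairs using ([]; _∷_)
open import Data.List.Relation.Unary.Unique.Propositional using (Unique)
import Data.List.Relation.Unary.Unique.Propositional.Properties as Unique
open import Data.List.Relation.Binary.Permutation.Propositional using (_↭_)
open import Data.List.Relation.Binary.Permutation.Propositional.Properties using (map⁺)
open import Data.List.Relation.Binary.BagAndSetEquality using (∼bag⇒↭)
open import Data.Product using (Σ; _×_; _,_; proj₁; proj₂)
open import Data.Sum using (_⊎_; inj₁; inj₂; [_,_]; map₂; swap)
open import Data.Empty using (⊥-elim)
open import Function using (_∘_; flip)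
open import Function.Bundles using (_⇔_; mk⇔; Equivalence)
import Function.Properties.Equivalence as ⇔
open import Relation.Nullary using (¬_; Dec; yes; no; does; _×-dec_)
open import Relation.Nullary.Decidable using (dec-true; dec-false; does-⇔)
open import Relation.Binary.PropositionalEquality hiding ([_])

private variable
  A B : Set
  k m n : ℕ

𝟙 : Bool → ℕ
𝟙 true = 1
𝟙 false = 0

true≢false : true ≢ false
true≢false ()

does-true⇒ : ∀ {P : Set} (p? : Dec P) → does p? ≡ true → P
does-true⇒ (yes p) _ = p

∨-true⁻ : ∀ {a b} → a ∨ b ≡ true → a ≡ true ⊎ b ≡ true
∨-true⁻ {true} _ = inj₁ refl
∨-true⁻ {false} e = inj₂ e

∨-trueʳ : ∀ a {b} → b ≡ true → a ∨ b ≡ true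
∨-trueʳ a refl = ∨-zeroʳ a

∑ : List A → (A → ℕ) → ℕ
∑ xs f = sum (map f xs)

syntax ∑ xs (λ x → e) = ∑[ x ∈ xs ] e

∑-cong : (xs : List A) {f g : A → ℕ} → (∀ x → f x ≡ g x) → ∑ xs f ≡ ∑ xs g
∑-cong xs f≗g = cong sum (map-cong f≗g xs)

∑-+ : (xs : List A) (f g : A → ℕ) → ∑[ x ∈ xs ] (f x + g x) ≡ ∑ xs f + ∑ xs g
∑-+ [] f g = refl
∑-+ (x ∷ xs) f g = begin
  f x + g x + ∑[ y ∈ xs ] (f y + g y) ≡⟨ cong (f x + g x +_) (∑-+ xs f g) ⟩
  f x + g x + (∑ xs f + ∑ xs g)       ≡⟨ interchange (f x) (g x) _ _ ⟩
  f x + ∑ xs f + (g x + ∑ xs g)       ∎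
  where open ≡-Reasoning

∑-++ : (xs ys : List A) (f : A → ℕ) → ∑ (xs ++ ys) f ≡ ∑ xs f + ∑ ys f
∑-++ xs ys f = trans (cong sum (map-++ f xs ys)) (sum-++ (map f xs) (map f ys))

∑-map : (g : A → B) (xs : List A) (f : B → ℕ) → ∑ (map g xs) f ≡ ∑ xs (f ∘ g)
∑-map g xs f = cong sum (sym (map-∘ xs))

∑-zero : (xs : List A) → ∑[ x ∈ xs ] 0 ≡ 0
∑-zero [] = refl
∑-zero (x ∷ xs) = ∑-zero xs

∑-comm : (xs : List A) (ys : List B) (f : A → B → ℕ) →
  ∑[ x ∈ xs ] ∑[ y ∈ ys ] f x y ≡ ∑[ y ∈ ys ] ∑[ x ∈ xs ] f x y
∑-comm [] ys f = sym (∑-zero ys)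
∑-comm (x ∷ xs) ys f =
  trans (cong (∑ ys (f x) +_) (∑-comm xs ys f)) (sym (∑-+ ys (f x) _))

∑-↭ : {xs ys : List A} (f : A → ℕ) → xs ↭ ys → ∑ xs f ≡ ∑ ys f
∑-↭ f xs↭ys = sum-↭ (map⁺ f xs↭ys)

∑< : ℕ → (ℕ → ℕ) → ℕ
∑< zero f = 0
∑< (suc n) f = f 0 + ∑< n (f ∘ suc)

syntax ∑< n (λ i → e) = ∑[ i < n ] e

∑<-cong : ∀ n {f g : ℕ → ℕ} → (∀ {i} → i < n → f i ≡ g i) → ∑< n f ≡ ∑< n g
∑<-cong zero _ = refl
∑<-cong (suc n) f≗g = cong₂ _+_ (f≗g z<s) (∑<-cong n (f≗g ∘ s<s))

∑<-zero : ∀ n {f : ℕ → ℕ} → (∀ {i} → i < n → f i ≡ 0) → ∑< n f ≡ 0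
∑<-zero zero _ = refl
∑<-zero (suc n) f≗0 = cong₂ _+_ (f≗0 z<s) (∑<-zero n (f≗0 ∘ s<s))

∑<-+ : ∀ n (f g : ℕ → ℕ) → ∑[ i < n ] (f i + g i) ≡ ∑< n f + ∑< n g
∑<-+ zero f g = refl
∑<-+ (suc n) f g = trans (cong (f 0 + g 0 +_) (∑<-+ n (f ∘ suc) (g ∘ suc))) (interchange (f 0) (g 0) _ _)

∑<-mono : ∀ n {f g : ℕ → ℕ} → (∀ i → f i ≤ g i) → ∑< n f ≤ ∑< n g
∑<-mono zero _ = z≤n
∑<-mono (suc n) f≤g = +-mono-≤ (f≤g 0) (∑<-mono n (f≤g ∘ suc))

∑<-comm : ∀ n m (f : ℕ → ℕ → ℕ) → ∑[ i < n ] ∑[ k < m ] f i k ≡ ∑[ k < m ] ∑[ i < n ] f i k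
∑<-comm zero m f = sym (∑<-zero m (λ _ → refl))
∑<-comm (suc n) m f = trans (cong (∑< m (f 0) +_) (∑<-comm n m (f ∘ suc))) (sym (∑<-+ m (f 0) _))

∑<-last : ∀ n (f : ℕ → ℕ) → ∑< (suc n) f ≡ ∑< n f + f n
∑<-last zero f = +-comm (f 0) 0
∑<-last (suc n) f = trans (cong (f 0 +_) (∑<-last n (f ∘ suc))) (sym (+-assoc (f 0) _ _))

∑<-shift : ∀ i n (f : ℕ → ℕ) → (∀ {j} → j < i → f j ≡ 0) → (∀ {k} → n ≤ i + k → f (i + k) ≡ 0) →
  ∑< n f ≡ ∑[ k < n ] f (i + k)
∑<-shift zero n f _ _ = refl
∑<-shift (suc i) zero f _ _ = refl
∑<-shift (suc i) (suc n) f before after = begin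
  f 0 + ∑[ j < n ] f (suc j) ≡⟨ cong₂ _+_ (before z<s) (∑<-shift i n (f ∘ suc) (before ∘ s<s) (after ∘ s≤s)) ⟩
  0 + ∑[ k < n ] f (suc i + k) ≡⟨ +-comm 0 _ ⟩
  ∑[ k < n ] f (suc i + k) + 0 ≡⟨ cong (∑[ k < n ] f (suc i + k) +_) (after (s≤s (m≤n+m n i))) ⟨
  ∑[ k < n ] f (suc i + k) + f (suc i + n) ≡⟨ ∑<-last n (λ k → f (suc i + k)) ⟨
  ∑[ k < suc n ] f (suc i + k) ∎
  where open ≡-Reasoning

∑<-telescope : ∀ m (f R : ℕ → ℕ) → (∀ t → f t + R (suc t) ≡ R t) → ∑< m f + R m ≡ R 0
∑<-telescope zero f R _ = refl
∑<-telescope (suc m) f R R-step = trans (+-assoc (f 0) _ (R (suc m)))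
  (trans (cong (f 0 +_) (∑<-telescope m (f ∘ suc) (R ∘ suc) (R-step ∘ suc))) (R-step 0))

∑<-𝟙≤ : ∀ n (g : ℕ → Bool) → ∑[ i < n ] 𝟙 (g i) ≤ n
∑<-𝟙≤ zero g = z≤n
∑<-𝟙≤ (suc n) g = ≤-trans (+-monoʳ-≤ (𝟙 (g 0)) (∑<-𝟙≤ n (g ∘ suc))) (𝟙+n≤1+n (g 0))
  where
  𝟙+n≤1+n : ∀ b → 𝟙 b + n ≤ suc n
  𝟙+n≤1+n true = ≤-refl
  𝟙+n≤1+n false = n≤1+n n

∑<-𝟙< : ∀ n {a} → a ≤ n → ∑[ i < n ] 𝟙 (does (i <? a)) ≡ a
∑<-𝟙< zero z≤n = refl
∑<-𝟙< (suc n) {zero} _ = ∑<-zero n (λ _ → refl)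
∑<-𝟙< (suc n) {suc a} (s≤s a≤n) = cong suc (∑<-𝟙< n a≤n)

∑<-𝟙-xor : ∀ n {a b} → a ≤ n → b ≤ n → ∑[ i < n ] 𝟙 (does (i <? a) xor does (i <? b)) ≡ ∣ a - b ∣
∑<-𝟙-xor zero z≤n z≤n = refl
∑<-𝟙-xor (suc n) {zero} {zero} _ _ = ∑<-zero n (λ _ → refl)
∑<-𝟙-xor (suc n) {zero} {suc b} _ (s≤s b≤n) = cong suc (∑<-𝟙< n b≤n)
∑<-𝟙-xor (suc n) {suc a} {zero} (s≤s a≤n) _ =
  cong suc (trans (∑<-cong n (λ {i} _ → cong 𝟙 (xor-identityʳ (does (i <? a))))) (∑<-𝟙< n a≤n))
∑<-𝟙-xor (suc n) {suc a} {suc b} (s≤s a≤n) (s≤s b≤n) = ∑<-𝟙-xor n a≤n b≤n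

∑<-𝟙-≟ : ∀ n {a} → a < n → ∑[ i < n ] 𝟙 (does (i ≟ a)) ≡ 1
∑<-𝟙-≟ (suc n) {zero} _ = cong suc (∑<-zero n (λ _ → refl))
∑<-𝟙-≟ (suc n) {suc a} (s≤s a<n) = ∑<-𝟙-≟ n a<n

∑□ : ℕ → (ℕ → ℕ → ℕ) → ℕ
∑□ n f = ∑[ i < n ] ∑[ j < n ] f i j

∑□-cong : ∀ n {f g : ℕ → ℕ → ℕ} → (∀ {i j} → i < n → j < n → f i j ≡ g i j) → ∑□ n f ≡ ∑□ n g
∑□-cong n f≗g = ∑<-cong n (λ i<n → ∑<-cong n (f≗g i<n))

∑□-+ : ∀ n (f g : ℕ → ℕ → ℕ) → ∑□ n (λ i j → f i j + g i j) ≡ ∑□ n f + ∑□ n g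
∑□-+ n f g = trans (∑<-cong n (λ {i} _ → ∑<-+ n (f i) (g i))) (∑<-+ n _ _)

∑□-mono : ∀ n {f g : ℕ → ℕ → ℕ} → (∀ i j → f i j ≤ g i j) → ∑□ n f ≤ ∑□ n g
∑□-mono n f≤g = ∑<-mono n (λ i → ∑<-mono n (f≤g i))

∑□-zero : ∀ n {f : ℕ → ℕ → ℕ} → (∀ i j → f i j ≡ 0) → ∑□ n f ≡ 0
∑□-zero n f≗0 = ∑<-zero n (λ {i} _ → ∑<-zero n (λ {j} _ → f≗0 i j))

∑□-cell : ∀ {n a b} → a < n → b < n → ∑□ n (λ i j → 𝟙 (does (i ≟ a) ∧ does (j ≟ b))) ≡ 1
∑□-cell {n} {a} {b} a<n b<n = trans (∑<-cong n (λ {i} _ → row i)) (∑<-𝟙-≟ n a<n)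
  where
  row : ∀ i → ∑[ j < n ] 𝟙 (does (i ≟ a) ∧ does (j ≟ b)) ≡ 𝟙 (does (i ≟ a))
  row i with does (i ≟ a)
  ... | true = ∑<-𝟙-≟ n b<n
  ... | false = ∑<-zero n (λ _ → refl)

-- Bit strings and suffix weights

bitStrings : ℕ → List (List Bool)
bitStrings zero = [] ∷ []
bitStrings (suc n) = map (true ∷_) (bitStrings n) ++ map (false ∷_) (bitStrings n)

∈-bitStrings⁻ : ∀ n {c} → c ∈ bitStrings n → length c ≡ n
∈-bitStrings⁻ zero (here refl) = refl
∈-bitStrings⁻ (suc n) c∈ with ∈-++⁻ (map (true ∷_) (bitStrings n)) c∈
... | inj₁ c∈₁ with ∈-map⁻ (true ∷_) c∈₁
...   | _ , d∈ , refl = cong suc (∈-bitStrings⁻ n d∈)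
∈-bitStrings⁻ (suc n) c∈ | inj₂ c∈₀ with ∈-map⁻ (false ∷_) c∈₀
...   | _ , d∈ , refl = cong suc (∈-bitStrings⁻ n d∈)

∈-bitStrings⁺ : ∀ c → c ∈ bitStrings (length c)
∈-bitStrings⁺ [] = here refl
∈-bitStrings⁺ (true ∷ c) = ∈-++⁺ˡ (∈-map⁺ (true ∷_) (∈-bitStrings⁺ c))
∈-bitStrings⁺ (false ∷ c) = ∈-++⁺ʳ (map (true ∷_) (bitStrings (length c))) (∈-map⁺ (false ∷_) (∈-bitStrings⁺ c))

bitStrings-unique : ∀ n → Unique (bitStrings n)
bitStrings-unique zero = All.[] ∷ []
bitStrings-unique (suc n) = Unique.++⁺ (Unique.map⁺ ∷-injectiveʳ (bitStrings-unique n))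
  (Unique.map⁺ ∷-injectiveʳ (bitStrings-unique n)) disjoint
  where
  disjoint : ∀ {c} → ¬ (c ∈ map (true ∷_) (bitStrings n) × c ∈ map (false ∷_) (bitStrings n))
  disjoint (c∈₁ , c∈₀) with ∈-map⁻ (true ∷_) c∈₁ | ∈-map⁻ (false ∷_) c∈₀
  ... | _ , _ , refl | _ , _ , ()

∑-bitStrings-suc : ∀ n (f : List Bool → ℕ) →
  ∑ (bitStrings (suc n)) f ≡ ∑[ c ∈ bitStrings n ] f (true ∷ c) + ∑[ c ∈ bitStrings n ] f (false ∷ c)
∑-bitStrings-suc n f = trans (∑-++ (map (true ∷_) (bitStrings n)) _ f)
  (cong₂ _+_ (∑-map _ (bitStrings n) f) (∑-map _ (bitStrings n) f))

∑-bitStrings-cong : ∀ n {f g : List Bool → ℕ} → (∀ c → length c ≡ n → f c ≡ g c) →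
  ∑ (bitStrings n) f ≡ ∑ (bitStrings n) g
∑-bitStrings-cong zero f≗g = cong (_+ 0) (f≗g [] refl)
∑-bitStrings-cong (suc n) {f} {g} f≗g = begin
  ∑ (bitStrings (suc n)) f ≡⟨ ∑-bitStrings-suc n f ⟩
  ∑[ c ∈ bitStrings n ] f (true ∷ c) + ∑[ c ∈ bitStrings n ] f (false ∷ c)
    ≡⟨ cong₂ _+_ (∑-bitStrings-cong n (λ c ∣c∣ → f≗g (true ∷ c) (cong suc ∣c∣)))
                 (∑-bitStrings-cong n (λ c ∣c∣ → f≗g (false ∷ c) (cong suc ∣c∣))) ⟩
  ∑[ c ∈ bitStrings n ] g (true ∷ c) + ∑[ c ∈ bitStrings n ] g (false ∷ c) ≡⟨ ∑-bitStrings-suc n g ⟨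
  ∑ (bitStrings (suc n)) g ∎
  where open ≡-Reasoning

∑-bitStrings-complement : ∀ n (f : List Bool → ℕ) → ∑[ c ∈ bitStrings n ] f (map not c) ≡ ∑ (bitStrings n) f
∑-bitStrings-complement zero f = refl
∑-bitStrings-complement (suc n) f = begin
  ∑[ c ∈ bitStrings (suc n) ] f (map not c) ≡⟨ ∑-bitStrings-suc n _ ⟩
  ∑[ c ∈ bitStrings n ] f (false ∷ map not c) + ∑[ c ∈ bitStrings n ] f (true ∷ map not c)
    ≡⟨ cong₂ _+_ (∑-bitStrings-complement n (f ∘ (false ∷_))) (∑-bitStrings-complement n (f ∘ (true ∷_))) ⟩
  ∑[ c ∈ bitStrings n ] f (false ∷ c) + ∑[ c ∈ bitStrings n ] f (true ∷ c) ≡⟨ +-comm (∑ (bitStrings n) (f ∘ (false ∷_))) _ ⟩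
  ∑[ c ∈ bitStrings n ] f (true ∷ c) + ∑[ c ∈ bitStrings n ] f (false ∷ c) ≡⟨ ∑-bitStrings-suc n f ⟨
  ∑ (bitStrings (suc n)) f ∎
  where open ≡-Reasoning

∑-bitStrings-+ : ∀ m n (f : List Bool → ℕ) →
  ∑ (bitStrings (m + n)) f ≡ ∑[ c ∈ bitStrings m ] ∑[ c′ ∈ bitStrings n ] f (c ++ c′)
∑-bitStrings-+ zero n f = sym (+-identityʳ _)
∑-bitStrings-+ (suc m) n f = begin
  ∑ (bitStrings (suc m + n)) f ≡⟨ ∑-bitStrings-suc (m + n) f ⟩
  ∑[ c ∈ bitStrings (m + n) ] f (true ∷ c) + ∑[ c ∈ bitStrings (m + n) ] f (false ∷ c)
    ≡⟨ cong₂ _+_ (∑-bitStrings-+ m n (f ∘ (true ∷_))) (∑-bitStrings-+ m n (f ∘ (false ∷_))) ⟩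
  _ ≡⟨ ∑-bitStrings-suc m _ ⟨
  ∑[ c ∈ bitStrings (suc m) ] ∑[ c′ ∈ bitStrings n ] f (c ++ c′) ∎
  where open ≡-Reasoning

weight : List Bool → ℕ
weight c = ∑ c 𝟙

weight-++ : ∀ c c′ → weight (c ++ c′) ≡ weight c + weight c′
weight-++ c c′ = ∑-++ c c′ 𝟙

weight-complement : ∀ c → weight (map not c) + weight c ≡ length c
weight-complement [] = refl
weight-complement (true ∷ c) = trans (+-suc (weight (map not c)) (weight c)) (cong suc (weight-complement c))
weight-complement (false ∷ c) = cong suc (weight-complement c)

weight≤length : ∀ c → weight c ≤ length c
weight≤length [] = z≤n
weight≤length (true ∷ c) = s≤s (weight≤length c)
weight≤length (false ∷ c) = m≤n⇒m≤1+n (weight≤length c)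

weight-applyUpTo : ∀ m (g : ℕ → Bool) → weight (applyUpTo g m) ≡ ∑[ t < m ] 𝟙 (g t)
weight-applyUpTo zero g = refl
weight-applyUpTo (suc m) g = cong (𝟙 (g 0) +_) (weight-applyUpTo m (g ∘ suc))

count-weight≡nCr : ∀ n r → ∑[ c ∈ bitStrings n ] 𝟙 (does (weight c ≟ r)) ≡ n C r
count-weight≡nCr zero zero = refl
count-weight≡nCr zero (suc r) = refl
count-weight≡nCr (suc n) zero = trans (∑-bitStrings-suc n _) (cong₂ _+_ (∑-zero (bitStrings n)) (count-weight≡nCr n zero))
count-weight≡nCr (suc n) (suc r) = trans (∑-bitStrings-suc n _)
  (trans (cong₂ _+_ (count-weight≡nCr n r) (count-weight≡nCr n (suc r))) (nCk+nC[k+1]≡[n+1]C[k+1] n r))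

suffixWeight : ℕ → List Bool → ℕ
suffixWeight k c = weight (drop k c)

suffixWeight≤ : ∀ k c → suffixWeight k c ≤ length c ∸ k
suffixWeight≤ k c = ≤-trans (weight≤length (drop k c)) (≤-reflexive (length-drop k c))

suffixWeight-small : ∀ {k i} c → length c ≤ i + k → suffixWeight k c ≤ i
suffixWeight-small {k} {i} c ∣c∣≤i+k =
  ≤-trans (suffixWeight≤ k c) (m≤n+o⇒m∸n≤o (length c) k (subst (length c ≤_) (+-comm i k) ∣c∣≤i+k))

suffixWeight-suc : ∀ k c → suffixWeight (suc k) c ≤ suffixWeight k c × suffixWeight k c ≤ suc (suffixWeight (suc k) c)
suffixWeight-suc zero [] = z≤n , z≤n
suffixWeight-suc zero (true ∷ c) = n≤1+n _ , ≤-refl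
suffixWeight-suc zero (false ∷ c) = ≤-refl , n≤1+n _
suffixWeight-suc (suc k) [] = z≤n , z≤n
suffixWeight-suc (suc k) (b ∷ c) = suffixWeight-suc k c

suffixWeight-antitone : ∀ c {k k′} → k ≤ k′ → suffixWeight k′ c ≤ suffixWeight k c
suffixWeight-antitone c {k} {k′} k≤k′ = subst (λ x → suffixWeight x c ≤ suffixWeight k c) (m+[n∸m]≡n k≤k′) (go (k′ ∸ k))
  where
  go : ∀ d → suffixWeight (k + d) c ≤ suffixWeight k c
  go zero = ≤-reflexive (cong (λ x → suffixWeight x c) (+-identityʳ k))
  go (suc d) = ≤-trans (≤-reflexive (cong (λ x → suffixWeight x c) (+-suc k d)))
                       (≤-trans (proj₁ (suffixWeight-suc (k + d) c)) (go d))

suffixWeight-Lipschitz : ∀ c k d → suffixWeight k c ≤ suffixWeight (k + d) c + d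
suffixWeight-Lipschitz c k zero = ≤-reflexive (trans (cong (λ x → suffixWeight x c) (sym (+-identityʳ k))) (sym (+-identityʳ _)))
suffixWeight-Lipschitz c k (suc d) = begin
  suffixWeight k c ≤⟨ suffixWeight-Lipschitz c k d ⟩
  suffixWeight (k + d) c + d ≤⟨ +-monoˡ-≤ d (proj₂ (suffixWeight-suc (k + d) c)) ⟩
  suc (suffixWeight (suc (k + d)) c) + d ≡⟨ cong (λ x → suc (suffixWeight x c) + d) (+-suc k d) ⟨
  suc (suffixWeight (k + suc d) c) + d ≡⟨ +-suc _ d ⟨
  suffixWeight (k + suc d) c + suc d ∎
  where open ≤-Reasoning

suffixWeight-injective : ∀ {c c′} → length c ≡ length c′ → (∀ k → suffixWeight k c ≡ suffixWeight k c′) → c ≡ c′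
suffixWeight-injective {[]} {[]} _ _ = refl
suffixWeight-injective {b ∷ c} {b′ ∷ c′} ∣c∣≡∣c′∣ same
  with suffixWeight-injective (suc-injective ∣c∣≡∣c′∣) (same ∘ suc)
... | refl = cong (_∷ c) (𝟙-injective (+-cancelʳ-≡ _ _ _ (same 0)))
  where
  𝟙-injective : ∀ {x y} → 𝟙 x ≡ 𝟙 y → x ≡ y
  𝟙-injective {false} {false} _ = refl
  𝟙-injective {true} {true} _ = refl

drop-applyUpTo : ∀ {A : Set} k m (g : ℕ → A) → drop k (applyUpTo g m) ≡ applyUpTo (g ∘ (k +_)) (m ∸ k)
drop-applyUpTo zero m g = refl
drop-applyUpTo (suc k) zero g = refl
drop-applyUpTo (suc k) (suc m) g = drop-applyUpTo k m (g ∘ suc)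

-- The counting identity

pairSum : ℕ → (List Bool → List Bool → ℕ) → ℕ
pairSum n F = ∑[ c ∈ bitStrings n ] ∑[ c′ ∈ bitStrings n ] F c c′

pairSum-cong : ∀ n {F G : List Bool → List Bool → ℕ} →
  (∀ c c′ → length c ≡ n → length c′ ≡ n → F c c′ ≡ G c c′) → pairSum n F ≡ pairSum n G
pairSum-cong n F≗G = ∑-bitStrings-cong n (λ c ∣c∣ → ∑-bitStrings-cong n (λ c′ ∣c′∣ → F≗G c c′ ∣c∣ ∣c′∣))

pairSum-+ : ∀ n (F G : List Bool → List Bool → ℕ) →
  pairSum n (λ c c′ → F c c′ + G c c′) ≡ pairSum n F + pairSum n G
pairSum-+ n F G = trans (∑-cong (bitStrings n) (λ c → ∑-+ (bitStrings n) (F c) (G c))) (∑-+ (bitStrings n) _ _)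

pairSum-comm : ∀ n (F : List Bool → List Bool → ℕ) → pairSum n F ≡ pairSum n (flip F)
pairSum-comm n F = ∑-comm (bitStrings n) (bitStrings n) F

pairSum-suc : ∀ n (F : List Bool → List Bool → ℕ) → pairSum (suc n) F ≡
  (pairSum n (λ c c′ → F (true ∷ c) (true ∷ c′)) + pairSum n (λ c c′ → F (true ∷ c) (false ∷ c′))) +
  (pairSum n (λ c c′ → F (false ∷ c) (true ∷ c′)) + pairSum n (λ c c′ → F (false ∷ c) (false ∷ c′)))
pairSum-suc n F = trans (∑-cong (bitStrings (suc n)) (λ c → ∑-bitStrings-suc n (F c)))
  (trans (∑-bitStrings-suc n _) (cong₂ _+_ (∑-+ (bitStrings n) _ _) (∑-+ (bitStrings n) _ _)))

profileDistance : ℕ → List Bool → List Bool → ℕ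
profileDistance n c c′ = ∑[ k < n ] ∣ suffixWeight k c - suffixWeight k c′ ∣

totalProfileDistance : ℕ → ℕ
totalProfileDistance n = pairSum n (profileDistance n)

totalWeightDistance : ℕ → ℕ
totalWeightDistance n = pairSum n (λ c c′ → ∣ weight c - weight c′ ∣)

equalWeightPairs : ℕ → ℕ
equalWeightPairs n = pairSum n (λ c c′ → 𝟙 (does (weight c ≟ weight c′)))

equalWeightPairs≡[2n]Cn : ∀ n → equalWeightPairs n ≡ (n + n) C n
equalWeightPairs≡[2n]Cn n = begin
  equalWeightPairs n ≡⟨ pairSum-cong n (λ c c′ _ ∣c′∣ → cong 𝟙 (complement-right (weight c) c′ ∣c′∣)) ⟩
  ∑[ c ∈ bitStrings n ] ∑[ c′ ∈ bitStrings n ] 𝟙 (does (weight c + weight (map not c′) ≟ n))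
    ≡⟨ ∑-cong (bitStrings n) (λ c → ∑-bitStrings-complement n (λ c′ → 𝟙 (does (weight c + weight c′ ≟ n)))) ⟩
  ∑[ c ∈ bitStrings n ] ∑[ c′ ∈ bitStrings n ] 𝟙 (does (weight c + weight c′ ≟ n))
    ≡⟨ ∑-cong (bitStrings n) (λ c → ∑-cong (bitStrings n) (λ c′ → cong (λ w → 𝟙 (does (w ≟ n))) (weight-++ c c′))) ⟨
  ∑[ c ∈ bitStrings n ] ∑[ c′ ∈ bitStrings n ] 𝟙 (does (weight (c ++ c′) ≟ n)) ≡⟨ ∑-bitStrings-+ n n _ ⟨
  ∑[ z ∈ bitStrings (n + n) ] 𝟙 (does (weight z ≟ n)) ≡⟨ count-weight≡nCr (n + n) n ⟩
  (n + n) C n ∎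
  where
  open ≡-Reasoning
  complement-right : ∀ x c′ → length c′ ≡ n → does (x ≟ weight c′) ≡ does (x + weight (map not c′) ≟ n)
  complement-right x c′ ∣c′∣ = does-⇔ (mk⇔ (λ x≡w → trans (cong (_+ w̄) x≡w) total)
                                            (λ x+w̄≡n → +-cancelʳ-≡ w̄ x (weight c′) (trans x+w̄≡n (sym total))))
                                       (x ≟ weight c′) (x + w̄ ≟ n)
    where
    w̄ = weight (map not c′)
    total : weight c′ + w̄ ≡ n
    total = trans (+-comm (weight c′) w̄) (trans (weight-complement c′) ∣c′∣)

∣suc-∣-step : ∀ x y → ∣ suc x - y ∣ + 𝟙 (does (x <? y)) ≡ ∣ x - y ∣ + (𝟙 (does (y <? x)) + 𝟙 (does (x ≟ y)))
∣suc-∣-step zero zero = refl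
∣suc-∣-step zero (suc y) = trans (+-comm y 1) (cong suc (sym (+-identityʳ y)))
∣suc-∣-step (suc x) zero = cong suc (trans (+-identityʳ (suc x)) (sym (+-comm x 1)))
∣suc-∣-step (suc x) (suc y) = ∣suc-∣-step x y

totalWeightDistance-shift : ∀ n →
  pairSum n (λ c c′ → ∣ suc (weight c) - weight c′ ∣) ≡ totalWeightDistance n + equalWeightPairs n
totalWeightDistance-shift n = +-cancelʳ-≡ _ _ _ (begin
  pairSum n (λ c c′ → ∣ suc (weight c) - weight c′ ∣) + L ≡⟨ pairSum-+ n _ _ ⟨
  pairSum n (λ c c′ → ∣ suc (weight c) - weight c′ ∣ + 𝟙 (does (weight c <? weight c′)))
    ≡⟨ pairSum-cong n (λ c c′ _ _ → ∣suc-∣-step (weight c) (weight c′)) ⟩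
  pairSum n (λ c c′ → ∣ weight c - weight c′ ∣ + (𝟙 (does (weight c′ <? weight c)) + 𝟙 (does (weight c ≟ weight c′))))
    ≡⟨ trans (pairSum-+ n _ _) (cong (totalWeightDistance n +_) (pairSum-+ n _ _)) ⟩
  totalWeightDistance n + (pairSum n (λ c c′ → 𝟙 (does (weight c′ <? weight c))) + equalWeightPairs n)
    ≡⟨ cong (λ z → totalWeightDistance n + (z + equalWeightPairs n)) (pairSum-comm n _) ⟨
  totalWeightDistance n + (L + equalWeightPairs n) ≡⟨ cong (totalWeightDistance n +_) (+-comm L _) ⟩
  totalWeightDistance n + (equalWeightPairs n + L) ≡⟨ +-assoc (totalWeightDistance n) _ L ⟨
  totalWeightDistance n + equalWeightPairs n + L ∎)
  where
  open ≡-Reasoning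
  L = pairSum n (λ c c′ → 𝟙 (does (weight c <? weight c′)))

totalWeightDistance-suc : ∀ n → totalWeightDistance (suc n) ≡ 4 * totalWeightDistance n + 2 * equalWeightPairs n
-- Equal first bits contribute ∣ x - y ∣, different ones ∣ suc x - y ∣ or its mirror image.
totalWeightDistance-suc n = begin
  totalWeightDistance (suc n) ≡⟨ pairSum-suc n _ ⟩
  (H + S) + (pairSum n (λ c c′ → ∣ weight c - suc (weight c′) ∣) + H)
    ≡⟨ cong (λ z → (H + S) + (z + H)) (trans (pairSum-comm n _)
         (pairSum-cong n (λ c c′ _ _ → ∣-∣-comm (weight c′) (suc (weight c))))) ⟩
  (H + S) + (S + H) ≡⟨ cong (λ z → (H + z) + (z + H)) (totalWeightDistance-shift n) ⟩
  (H + (H + E)) + ((H + E) + H) ≡⟨ collect H E ⟩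
  4 * H + 2 * E ∎
  where
  open ≡-Reasoning
  H = totalWeightDistance n
  E = equalWeightPairs n
  S = pairSum n (λ c c′ → ∣ suc (weight c) - weight c′ ∣)
  collect : ∀ h e → (h + (h + e)) + ((h + e) + h) ≡ 4 * h + 2 * e
  collect = solve-∀

totalProfileDistance-suc : ∀ n → totalProfileDistance (suc n) ≡ totalWeightDistance (suc n) + 4 * totalProfileDistance n
totalProfileDistance-suc n = begin
  totalProfileDistance (suc n)
    ≡⟨ trans (pairSum-suc n _) (cong₂ _+_ (cong₂ _+_ (pairSum-+ n _ _) (pairSum-+ n _ _))
                                          (cong₂ _+_ (pairSum-+ n _ _) (pairSum-+ n _ _))) ⟩
  ((D true true + W) + (D true false + W)) + ((D false true + W) + (D false false + W))
    ≡⟨ regroup (D true true) (D true false) (D false true) (D false false) W ⟩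
  ((D true true + D true false) + (D false true + D false false)) + 4 * W
    ≡⟨ cong (_+ 4 * W) (pairSum-suc n _) ⟨
  totalWeightDistance (suc n) + 4 * W ∎
  where
  open ≡-Reasoning
  W = totalProfileDistance n
  D : Bool → Bool → ℕ
  D b b′ = pairSum n (λ c c′ → ∣ weight (b ∷ c) - weight (b′ ∷ c′) ∣)
  regroup : ∀ a b c d w → ((a + w) + (b + w)) + ((c + w) + (d + w)) ≡ ((a + b) + (c + d)) + 4 * w
  regroup = solve-∀

[1+k]*[1+m]C[1+k]≡[1+m]*mCk : ∀ m k → suc k * (suc m C suc k) ≡ suc m * (m C k)
[1+k]*[1+m]C[1+k]≡[1+m]*mCk zero zero = refl
[1+k]*[1+m]C[1+k]≡[1+m]*mCk zero (suc k) = *-zeroʳ (suc (suc k))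
[1+k]*[1+m]C[1+k]≡[1+m]*mCk (suc m) zero = trans (+-identityʳ _) (trans (nC1≡n (suc (suc m))) (sym (*-identityʳ (suc (suc m)))))
[1+k]*[1+m]C[1+k]≡[1+m]*mCk (suc m) (suc k) = begin
  suc (suc k) * (suc (suc m) C suc (suc k))
    ≡⟨ cong (suc (suc k) *_) (nCk+nC[k+1]≡[n+1]C[k+1] (suc m) (suc k)) ⟨
  suc (suc k) * (b + suc m C suc (suc k))
    ≡⟨ *-distribˡ-+ (suc (suc k)) b _ ⟩
  (b + suc k * b) + suc (suc k) * (suc m C suc (suc k))
    ≡⟨ cong₂ (λ x y → (b + x) + y) ([1+k]*[1+m]C[1+k]≡[1+m]*mCk m k) ([1+k]*[1+m]C[1+k]≡[1+m]*mCk m (suc k)) ⟩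
  (b + suc m * (m C k)) + suc m * (m C suc k)
    ≡⟨ trans (+-assoc b _ _) (cong (b +_) (sym (*-distribˡ-+ (suc m) (m C k) (m C suc k)))) ⟩
  b + suc m * (m C k + m C suc k)
    ≡⟨ cong (λ x → b + suc m * x) (nCk+nC[k+1]≡[n+1]C[k+1] m k) ⟩
  suc (suc m) * b ∎
  where
  open ≡-Reasoning
  b = suc m C suc k

[2+2n]C[1+n]≡2*[1+2n]C[1+n] : ∀ n → (suc n + suc n) C suc n ≡ 2 * (suc (n + n) C suc n)
[2+2n]C[1+n]≡2*[1+2n]C[1+n] n = begin
  (suc n + suc n) C suc n ≡⟨ cong (λ m → suc m C suc n) (+-suc n n) ⟩
  suc (suc (n + n)) C suc n ≡⟨ nCk+nC[k+1]≡[n+1]C[k+1] (suc (n + n)) n ⟨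
  suc (n + n) C n + suc (n + n) C suc n ≡⟨ cong (_+ suc (n + n) C suc n) symmetric ⟩
  suc (n + n) C suc n + suc (n + n) C suc n ≡⟨ cong (suc (n + n) C suc n +_) (+-identityʳ _) ⟨
  2 * (suc (n + n) C suc n) ∎
  where
  open ≡-Reasoning
  symmetric : suc (n + n) C n ≡ suc (n + n) C suc n
  symmetric = trans (nCk≡nC[n∸k] (m≤n⇒m≤1+n (m≤m+n n n))) (cong (suc (n + n) C_) (m+n∸n≡m (suc n) n))

[1+n]*[2+2n]C[1+n]≡2*[1+2n]*[2n]Cn : ∀ n → suc n * ((suc n + suc n) C suc n) ≡ 2 * (suc (n + n) * ((n + n) C n))
[1+n]*[2+2n]C[1+n]≡2*[1+2n]*[2n]Cn n = begin
  suc n * ((suc n + suc n) C suc n) ≡⟨ cong (suc n *_) ([2+2n]C[1+n]≡2*[1+2n]C[1+n] n) ⟩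
  suc n * (2 * (suc (n + n) C suc n)) ≡⟨ x∙yz≈y∙xz (suc n) 2 (suc (n + n) C suc n) ⟩
  2 * (suc n * (suc (n + n) C suc n)) ≡⟨ cong (2 *_) ([1+k]*[1+m]C[1+k]≡[1+m]*mCk (n + n) n) ⟩
  2 * (suc (n + n) * ((n + n) C n)) ∎
  where open ≡-Reasoning

totalWeightDistance≡n*[2n]Cn : ∀ n → totalWeightDistance n ≡ n * ((n + n) C n)
totalWeightDistance≡n*[2n]Cn zero = refl
totalWeightDistance≡n*[2n]Cn (suc n) = begin
  totalWeightDistance (suc n) ≡⟨ totalWeightDistance-suc n ⟩
  4 * totalWeightDistance n + 2 * equalWeightPairs n
    ≡⟨ cong₂ (λ h e → 4 * h + 2 * e) (totalWeightDistance≡n*[2n]Cn n) (equalWeightPairs≡[2n]Cn n) ⟩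
  4 * (n * b) + 2 * b ≡⟨ collect n b ⟩
  2 * (suc (n + n) * b) ≡⟨ [1+n]*[2+2n]C[1+n]≡2*[1+2n]*[2n]Cn n ⟨
  suc n * ((suc n + suc n) C suc n) ∎
  where
  open ≡-Reasoning
  b = (n + n) C n
  collect : ∀ n b → 4 * (n * b) + 2 * b ≡ 2 * (suc (n + n) * b)
  collect = solve-∀

3*totalProfileDistance≡n*[1+2n]*[2n]Cn : ∀ n → 3 * totalProfileDistance n ≡ n * suc (n + n) * ((n + n) C n)
3*totalProfileDistance≡n*[1+2n]*[2n]Cn zero = refl
3*totalProfileDistance≡n*[1+2n]*[2n]Cn (suc n) = begin
  3 * totalProfileDistance (suc n) ≡⟨ cong (3 *_) (totalProfileDistance-suc n) ⟩
  3 * (totalWeightDistance (suc n) + 4 * totalProfileDistance n) ≡⟨ distribute (totalWeightDistance (suc n)) (totalProfileDistance n) ⟩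
  3 * totalWeightDistance (suc n) + 4 * (3 * totalProfileDistance n)
    ≡⟨ cong₂ (λ h w → 3 * h + 4 * w) (totalWeightDistance≡n*[2n]Cn (suc n)) (3*totalProfileDistance≡n*[1+2n]*[2n]Cn n) ⟩
  3 * (suc n * b′) + 4 * (n * suc (n + n) * b)
    ≡⟨ cong (λ x → 3 * x + 4 * (n * suc (n + n) * b)) ([1+n]*[2+2n]C[1+n]≡2*[1+2n]*[2n]Cn n) ⟩
  3 * (2 * (suc (n + n) * b)) + 4 * (n * suc (n + n) * b) ≡⟨ collect n b ⟩
  suc (suc n + suc n) * (2 * (suc (n + n) * b)) ≡⟨ cong (suc (suc n + suc n) *_) ([1+n]*[2+2n]C[1+n]≡2*[1+2n]*[2n]Cn n) ⟨
  suc (suc n + suc n) * (suc n * b′) ≡⟨ x∙yz≈y∙xz (suc (suc n + suc n)) (suc n) b′ ⟩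
  suc n * (suc (suc n + suc n) * b′) ≡⟨ *-assoc (suc n) (suc (suc n + suc n)) b′ ⟨
  suc n * suc (suc n + suc n) * b′ ∎
  where
  open ≡-Reasoning
  b = (n + n) C n
  b′ = (suc n + suc n) C suc n
  distribute : ∀ h w → 3 * (h + 4 * w) ≡ 3 * h + 4 * (3 * w)
  distribute = solve-∀
  collect : ∀ n b → 3 * (2 * (suc (n + n) * b)) + 4 * (n * suc (n + n) * b) ≡ suc (suc n + suc n) * (2 * (suc (n + n) * b))
  collect = solve-∀

n*[1+2n]*[2n]Cn≡2n*[2n+1]*[2n∸1]Cn : ∀ n → n * suc (n + n) * ((n + n) C n) ≡ (2 * n) * (2 * n + 1) * ((2 * n ∸ 1) C n)
n*[1+2n]*[2n]Cn≡2n*[2n+1]*[2n∸1]Cn zero = refl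
n*[1+2n]*[2n]Cn≡2n*[2n+1]*[2n∸1]Cn (suc m) = begin
  suc m * suc (suc m + suc m) * ((suc m + suc m) C suc m)
    ≡⟨ cong (suc m * suc (suc m + suc m) *_) ([2+2n]C[1+n]≡2*[1+2n]C[1+n] m) ⟩
  suc m * suc (suc m + suc m) * (2 * b) ≡⟨ reorder m b ⟩
  (2 * suc m) * (2 * suc m + 1) * b ≡⟨ cong (λ x → (2 * suc m) * (2 * suc m + 1) * (x C suc m)) (cong (_∸ 1) (double m)) ⟨
  (2 * suc m) * (2 * suc m + 1) * ((2 * suc m ∸ 1) C suc m) ∎
  where
  open ≡-Reasoning
  b = suc (m + m) C suc m
  reorder : ∀ m b → suc m * suc (suc m + suc m) * (2 * b) ≡ (2 * suc m) * (2 * suc m + 1) * b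
  reorder = solve-∀
  double : ∀ m → 2 * suc m ≡ suc (suc (m + m))
  double = solve-∀

-- Out of range, entries read as false.
atℕ : Vec Bool k → ℕ → Bool
atℕ [] _ = false
atℕ (x ∷ v) zero = x
atℕ (x ∷ v) (suc j) = atℕ v j

entry : Vec (Vec Bool k) m → ℕ → ℕ → Bool
entry [] _ _ = false
entry (r ∷ M) zero j = atℕ r j
entry (r ∷ M) (suc i) j = entry M i j

_∋⟨_,_⟩ : Vec (Vec Bool k) m → ℕ → ℕ → Set
M ∋⟨ i , j ⟩ = entry M i j ≡ true

atℕ-lookup : (v : Vec Bool k) (j : Fin k) → atℕ v (toℕ j) ≡ lookup v j
atℕ-lookup (x ∷ v) fzero = refl
atℕ-lookup (x ∷ v) (fsuc j) = atℕ-lookup v j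

entry-lookup : (M : Vec (Vec Bool k) m) (i : Fin m) (j : Fin k) → entry M (toℕ i) (toℕ j) ≡ lookup (lookup M i) j
entry-lookup (r ∷ M) fzero j = atℕ-lookup r j
entry-lookup (r ∷ M) (fsuc i) j = entry-lookup M i j

atℕ-true⇒< : (v : Vec Bool k) {j : ℕ} → atℕ v j ≡ true → j < k
atℕ-true⇒< (x ∷ v) {zero} _ = z<s
atℕ-true⇒< (x ∷ v) {suc j} e = s<s (atℕ-true⇒< v e)

entry-true⇒< : (M : Vec (Vec Bool k) m) {i j : ℕ} → M ∋⟨ i , j ⟩ → i < m × j < k
entry-true⇒< (r ∷ M) {zero} e = z<s , atℕ-true⇒< r e
entry-true⇒< (r ∷ M) {suc i} e = let i<m , j<k = entry-true⇒< M e in s<s i<m , j<k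

entry-≥ : (M : Mat n) {i j : ℕ} → n ≤ j → entry M i j ≡ false
entry-≥ M n≤j = ¬-not (λ e → <⇒≱ (proj₂ (entry-true⇒< M e)) n≤j)

atℕ-injective : (v w : Vec Bool k) → (∀ j → atℕ v j ≡ atℕ w j) → v ≡ w
atℕ-injective [] [] _ = refl
atℕ-injective (x ∷ v) (y ∷ w) v≗w = cong₂ _∷_ (v≗w 0) (atℕ-injective v w (v≗w ∘ suc))

entry-injective : (M N : Vec (Vec Bool k) m) → (∀ i j → entry M i j ≡ entry N i j) → M ≡ N
entry-injective [] [] _ = refl
entry-injective (r ∷ M) (s ∷ N) M≗N = cong₂ _∷_ (atℕ-injective r s (M≗N 0)) (entry-injective M N (M≗N ∘ suc))

atℕ-tabulate : (f : ℕ → Bool) {j : ℕ} → j < k → atℕ (tabulate {n = k} (f ∘ toℕ)) j ≡ f j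
atℕ-tabulate f {zero} (s≤s _) = refl
atℕ-tabulate f {suc j} (s≤s j<k) = atℕ-tabulate (f ∘ suc) j<k

fromEntries : ∀ n → (ℕ → ℕ → Bool) → Mat n
fromEntries n g = tabulate (λ i → tabulate (λ j → g (toℕ i) (toℕ j)))

entry-fromEntries< : ∀ (g : ℕ → ℕ → Bool) {i j} → i < m → j < k →
  entry (tabulate {n = m} (λ i → tabulate {n = k} (λ j → g (toℕ i) (toℕ j)))) i j ≡ g i j
entry-fromEntries< g {zero} (s≤s _) j<k = atℕ-tabulate (g 0) j<k
entry-fromEntries< g {suc i} (s≤s i<m) j<k = entry-fromEntries< (g ∘ suc) i<m j<k

entry-fromEntries : ∀ (g : ℕ → ℕ → Bool) → (∀ {i j} → g i j ≡ true → i < n × j < n) →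
  ∀ i j → entry (fromEntries n g) i j ≡ g i j
entry-fromEntries {n} g support i j with g i j in gij
... | true = let i<n , j<n = support gij in trans (entry-fromEntries< g i<n j<n) gij
... | false with entry (fromEntries n g) i j in eij
...   | false = refl
...   | true = let i<n , j<n = entry-true⇒< (fromEntries n g) eij in
               trans (sym eij) (trans (entry-fromEntries< g i<n j<n) gij)

_⊆ℕ_ : Mat n → Mat n → Set
A ⊆ℕ B = ∀ {i j} → A ∋⟨ i , j ⟩ → B ∋⟨ i , j ⟩

⊆-antisym : {A B : Mat n} → A ⊆ℕ B → B ⊆ℕ A → A ≡ B
⊆-antisym {A = A} {B} A⊆B B⊆A = entry-injective A B λ i j → Bool-ext (A⊆B {i} {j}) B⊆A
  where
  Bool-ext : ∀ {a b} → (a ≡ true → b ≡ true) → (b ≡ true → a ≡ true) → a ≡ b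
  Bool-ext {false} {false} _ _ = refl
  Bool-ext {false} {true} _ b⇒a = b⇒a refl
  Bool-ext {true} a⇒b _ = sym (a⇒b refl)

∋⟨⟩⇒∋[] : (M : Mat n) {i j : ℕ} (i<n : i < n) (j<n : j < n) → M ∋⟨ i , j ⟩ → M ∋[ fromℕ< i<n , fromℕ< j<n ]
∋⟨⟩⇒∋[] M i<n j<n e =
  trans (sym (entry-lookup M (fromℕ< i<n) (fromℕ< j<n))) (trans (cong₂ (entry M) (toℕ-fromℕ< i<n) (toℕ-fromℕ< j<n)) e)

∋[]⇒∋⟨⟩ : (M : Mat n) {i j : Fin n} → M ∋[ i , j ] → M ∋⟨ toℕ i , toℕ j ⟩
∋[]⇒∋⟨⟩ M {i} {j} e = trans (entry-lookup M i j) e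

⊆⇒⊆ℕ : {A B : Mat n} → A ⊆ B → A ⊆ℕ B
⊆⇒⊆ℕ {A = A} {B} A⊆B e = let i<n , j<n = entry-true⇒< A e in
  subst₂ (λ i j → B ∋⟨ i , j ⟩) (toℕ-fromℕ< i<n) (toℕ-fromℕ< j<n) (∋[]⇒∋⟨⟩ B (A⊆B _ _ (∋⟨⟩⇒∋[] A i<n j<n e)))

⊆ℕ⇒⊆ : {A B : Mat n} → A ⊆ℕ B → A ⊆ B
⊆ℕ⇒⊆ {A = A} {B} A⊆B i j e = trans (sym (entry-lookup B i j)) (A⊆B (∋[]⇒∋⟨⟩ A e))

record IsIdealℕ (M : Mat n) : Set where
  field
    staircase : ∀ {i j} → M ∋⟨ i , j ⟩ → i ≤ j
    downClosed : ∀ {i j i′ j′} → M ∋⟨ i , j ⟩ → i′ ≤ j′ → i′ ≤ i → j′ ≤ j → M ∋⟨ i′ , j′ ⟩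

IsIdeal⇒IsIdealℕ : {M : Mat n} → IsIdeal M → IsIdealℕ M
IsIdeal⇒IsIdealℕ {n} {M} (staircase , downClosed) = record { staircase = staircaseℕ ; downClosed = downClosedℕ }
  where
  fromℕ<-mono : ∀ {a b} (a<n : a < n) (b<n : b < n) → a ≤ b → toℕ (fromℕ< a<n) ≤ toℕ (fromℕ< b<n)
  fromℕ<-mono a<n b<n = subst₂ _≤_ (sym (toℕ-fromℕ< a<n)) (sym (toℕ-fromℕ< b<n))
  staircaseℕ : ∀ {i j} → M ∋⟨ i , j ⟩ → i ≤ j
  staircaseℕ e = let i<n , j<n = entry-true⇒< M e in
    subst₂ _≤_ (toℕ-fromℕ< i<n) (toℕ-fromℕ< j<n) (staircase _ _ (∋⟨⟩⇒∋[] M i<n j<n e))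
  downClosedℕ : ∀ {i j i′ j′} → M ∋⟨ i , j ⟩ → i′ ≤ j′ → i′ ≤ i → j′ ≤ j → M ∋⟨ i′ , j′ ⟩
  downClosedℕ e i′≤j′ i′≤i j′≤j =
    let i<n , j<n = entry-true⇒< M e
        i′<n = ≤-<-trans i′≤i i<n
        j′<n = ≤-<-trans j′≤j j<n
    in subst₂ (λ a b → M ∋⟨ a , b ⟩) (toℕ-fromℕ< i′<n) (toℕ-fromℕ< j′<n) (∋[]⇒∋⟨⟩ M
         (downClosed _ _ _ _ (∋⟨⟩⇒∋[] M i<n j<n e) (fromℕ<-mono i′<n j′<n i′≤j′)
                     (fromℕ<-mono i′<n i<n i′≤i) (fromℕ<-mono j′<n j<n j′≤j)))

IsIdealℕ⇒IsIdeal : {M : Mat n} → IsIdealℕ M → IsIdeal M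
IsIdealℕ⇒IsIdeal {M = M} ideal =
  (λ i j e → staircase (∋[]⇒∋⟨⟩ M e)) ,
  (λ i j i′ j′ e i′≤j′ i′≤i j′≤j → trans (sym (entry-lookup M i′ j′)) (downClosed (∋[]⇒∋⟨⟩ M e) i′≤j′ i′≤i j′≤j))
  where open IsIdealℕ ideal

record Least (n : ℕ) (P : ℕ → Set) : Set where
  field
    index : ℕ
    index<n : index < n
    holds : P index
    below : ∀ {i} → i < index → ¬ P i

least? : {P : ℕ → Set} → (∀ i → Dec (P i)) → ∀ n → Least n P ⊎ (∀ {i} → i < n → ¬ P i)
least? P? zero = inj₂ λ ()
least? P? (suc n) with P? 0 | least? (P? ∘ suc) n
... | yes P0 | _ = inj₁ record { index = 0 ; index<n = z<s ; holds = P0 ; below = λ () }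
... | no ¬P0 | inj₁ l = let open Least l in inj₁ record
  { index = suc index ; index<n = s<s index<n ; holds = holds
  ; below = λ { {zero} _ → ¬P0 ; {suc i} i<index → below (s<s⁻¹ i<index) } }
... | no ¬P0 | inj₂ none = inj₂ λ { {zero} _ → ¬P0 ; {suc i} i<n → none (s<s⁻¹ i<n) }

record LexLeast (n : ℕ) (R : ℕ → ℕ → Set) : Set where
  field
    row col : ℕ
    row<n : row < n
    col<n : col < n
    holds : R row col
    earlierRow : ∀ {i j} → i < row → j < n → ¬ R i j
    earlierCol : ∀ {j} → j < col → ¬ R row j

  minimal : ∀ {i j} → R i j → i ≤ row → j ≤ col → i ≡ row × j ≡ col
  minimal r i≤row j≤col with m≤n⇒m<n∨m≡n i≤row | m≤n⇒m<n∨m≡n j≤col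
  ... | inj₁ i<row | _ = ⊥-elim (earlierRow i<row (≤-<-trans j≤col col<n) r)
  ... | inj₂ refl | inj₁ j<col = ⊥-elim (earlierCol j<col r)
  ... | inj₂ refl | inj₂ refl = refl , refl

lexLeast? : {R : ℕ → ℕ → Set} → (∀ i j → Dec (R i j)) → ∀ n →
  LexLeast n R ⊎ (∀ {i j} → i < n → j < n → ¬ R i j)
lexLeast? {R} R? n with least? (λ i → anyUpTo? (R? i) n) n
... | inj₂ none = inj₂ λ i<n j<n r → none i<n (_ , j<n , r)
... | inj₁ rows with least? (R? (Least.index rows)) n
...   | inj₁ cols = inj₁ record
  { row = Least.index rows ; col = Least.index cols
  ; row<n = Least.index<n rows ; col<n = Least.index<n cols ; holds = Least.holds cols
  ; earlierRow = λ i<row j<n r → Least.below rows i<row (_ , j<n , r)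
  ; earlierCol = Least.below cols }
...   | inj₂ none = let _ , j<n , r = Least.holds rows in ⊥-elim (none j<n r)

_∖_ : Mat n → Mat n → ℕ → ℕ → Set
(A ∖ B) i j = A ∋⟨ i , j ⟩ × entry B i j ≡ false

_⊆?_ : (A B : Mat n) → A ⊆ℕ B ⊎ LexLeast n (A ∖ B)
_⊆?_ {n} A B with lexLeast? (λ i j → (entry A i j ≟ᵇ true) ×-dec (entry B i j ≟ᵇ false)) n
... | inj₁ least = inj₂ least
... | inj₂ none = inj₁ λ e → let i<n , j<n = entry-true⇒< A e in ¬-not (λ f → none i<n j<n (e , f))

LexLeast⇒⊈ : {A B : Mat n} → LexLeast n (A ∖ B) → ¬ (A ⊆ℕ B)
LexLeast⇒⊈ least A⊆B = let A∋ , B∌ = LexLeast.holds least in true≢false (trans (sym (A⊆B A∋)) B∌)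

-- Distance in the Hasse diagram is Hamming distance

hamming : Mat n → Mat n → ℕ
hamming {n} A B = ∑□ n (λ i j → 𝟙 (entry A i j xor entry B i j))

hamming-self : (A : Mat n) → hamming A A ≡ 0
hamming-self {n} A = ∑□-zero n (λ i j → cong 𝟙 (xor-same (entry A i j)))

hamming-comm : (A B : Mat n) → hamming A B ≡ hamming B A
hamming-comm {n} A B = ∑□-cong n (λ {i} {j} _ _ → cong 𝟙 (xor-comm (entry A i j) (entry B i j)))

𝟙-xor-triangle : ∀ a b c → 𝟙 (a xor c) ≤ 𝟙 (a xor b) + 𝟙 (b xor c)
𝟙-xor-triangle false false c = ≤-refl
𝟙-xor-triangle true true c = ≤-refl
𝟙-xor-triangle false true false = z≤n
𝟙-xor-triangle false true true = s≤s z≤n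
𝟙-xor-triangle true false false = s≤s z≤n
𝟙-xor-triangle true false true = z≤n

hamming-triangle : (X Y Z : Mat n) → hamming X Z ≤ hamming X Y + hamming Y Z
hamming-triangle {n} X Y Z = ≤-trans
  (∑□-mono n (λ i j → 𝟙-xor-triangle (entry X i j) (entry Y i j) (entry Z i j))) (≤-reflexive (∑□-+ n _ _))

insertCell : ℕ → ℕ → Mat n → Mat n
insertCell {n} a b M = fromEntries n (λ i j → entry M i j ∨ does ((i ≟ a) ×-dec (j ≟ b)))

-- Every cell below the lexicographically least cell of p ∖ m is lexicographically
-- smaller, hence lies in m; so adding that cell to m gives an ideal covering m.
module OneCellExtension {m p : Mat n} (m-ideal : IsIdealℕ m) (p-ideal : IsIdealℕ p) (m⊆p : m ⊆ℕ p)
                        (least : LexLeast n (p ∖ m)) where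
  open LexLeast least renaming (row to a; col to b; row<n to a<n; col<n to b<n)
  private
    module m = IsIdealℕ m-ideal
    module p = IsIdealℕ p-ideal

  K : Mat n
  K = insertCell a b m

  isCell : ℕ → ℕ → Bool
  isCell i j = does ((i ≟ a) ×-dec (j ≟ b))

  isCell⇒≡ : ∀ {i j} → isCell i j ≡ true → i ≡ a × j ≡ b
  isCell⇒≡ {i} {j} = does-true⇒ ((i ≟ a) ×-dec (j ≟ b))

  isCell-ab : isCell a b ≡ true
  isCell-ab = dec-true ((a ≟ a) ×-dec (b ≟ b)) (refl , refl)

  entry-K : ∀ i j → entry K i j ≡ entry m i j ∨ isCell i j
  entry-K = entry-fromEntries (λ i j → entry m i j ∨ isCell i j) support
    where
    cell<n : ∀ {i j} → isCell i j ≡ true → i < n × j < n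
    cell<n {i} {j} e with isCell⇒≡ {i} {j} e
    ... | refl , refl = a<n , b<n
    support : ∀ {i j} → entry m i j ∨ isCell i j ≡ true → i < n × j < n
    support {i} {j} e = [ entry-true⇒< m , cell<n {i} {j} ] (∨-true⁻ {entry m i j} e)

  m⊆K : m ⊆ℕ K
  m⊆K {i} {j} e = trans (entry-K i j) (cong (_∨ isCell i j) e)

  K∋ab : K ∋⟨ a , b ⟩
  K∋ab = trans (entry-K a b) (∨-trueʳ (entry m a b) isCell-ab)

  K-cases : ∀ {i j} → K ∋⟨ i , j ⟩ → m ∋⟨ i , j ⟩ ⊎ (i ≡ a × j ≡ b)
  K-cases {i} {j} e = map₂ (isCell⇒≡ {i} {j}) (∨-true⁻ (trans (sym (entry-K i j)) e))

  p∋ab : p ∋⟨ a , b ⟩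
  p∋ab = proj₁ holds

  K⊆p : K ⊆ℕ p
  K⊆p e with K-cases e
  ... | inj₁ m∋ = m⊆p m∋
  ... | inj₂ (refl , refl) = proj₁ holds

  K-ideal : IsIdealℕ K
  K-ideal = record { staircase = staircase ; downClosed = downClosed }
    where
    staircase : ∀ {i j} → K ∋⟨ i , j ⟩ → i ≤ j
    staircase e with K-cases e
    ... | inj₁ m∋ = m.staircase m∋
    ... | inj₂ (refl , refl) = p.staircase (proj₁ holds)
    downClosed : ∀ {i j i′ j′} → K ∋⟨ i , j ⟩ → i′ ≤ j′ → i′ ≤ i → j′ ≤ j → K ∋⟨ i′ , j′ ⟩
    downClosed e i′≤j′ i′≤i j′≤j with K-cases e
    ... | inj₁ m∋ = m⊆K (m.downClosed m∋ i′≤j′ i′≤i j′≤j)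
    ... | inj₂ (refl , refl) with entry m _ _ in m∋?
    ...   | true = m⊆K m∋?
    ...   | false with minimal (p.downClosed (proj₁ holds) i′≤j′ i′≤i j′≤j , m∋?) i′≤i j′≤j
    ...     | refl , refl = K∋ab

  K-least : ∀ {K′ : Mat n} → m ⊆ℕ K′ → K′ ∋⟨ a , b ⟩ → K ⊆ℕ K′
  K-least m⊆K′ K′∋ab e with K-cases e
  ... | inj₁ m∋ = m⊆K′ m∋
  ... | inj₂ (refl , refl) = K′∋ab

  m⊂K : m ⊂ K
  m⊂K = ⊆ℕ⇒⊆ {A = m} {K} m⊆K , λ K⊆m → true≢false (trans (sym (⊆⇒⊆ℕ {A = K} {m} K⊆m K∋ab)) (proj₂ holds))

  m⋖K : Covers m K
  m⋖K = IsIdealℕ⇒IsIdeal m-ideal , IsIdealℕ⇒IsIdeal K-ideal , m⊂K , nothingBetween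
    where
    nothingBetween : ∀ K′ → IsIdeal K′ → m ⊂ K′ → ¬ (K′ ⊂ K)
    nothingBetween K′ _ (m⊆K′ , K′⊈m) (K′⊆K , K⊈K′) with K′ ⊆? m
    ... | inj₁ K′⊆m = K′⊈m (⊆ℕ⇒⊆ {A = K′} {m} K′⊆m)
    ... | inj₂ new with LexLeast.holds new
    ...   | K′∋ , m∌ with K-cases (⊆⇒⊆ℕ {A = K′} {K} K′⊆K K′∋)
    ...     | inj₁ m∋ = true≢false (trans (sym m∋) m∌)
    ...     | inj₂ (refl , refl) = K⊈K′ (⊆ℕ⇒⊆ {A = K} {K′} (K-least {K′} (⊆⇒⊆ℕ {A = m} {K′} m⊆K′) K′∋))

  hamming-K : ∀ {q : Mat n} → q ∋⟨ a , b ⟩ → hamming m q ≡ suc (hamming K q)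
  hamming-K {q} q∋ab = begin
    hamming m q ≡⟨ ∑□-cong n (λ {i} {j} _ _ → split i j) ⟩
    ∑□ n (λ i j → 𝟙 (entry K i j xor entry q i j) + 𝟙 (isCell i j)) ≡⟨ ∑□-+ n _ _ ⟩
    hamming K q + ∑□ n (λ i j → 𝟙 (isCell i j)) ≡⟨ cong (hamming K q +_) (∑□-cell a<n b<n) ⟩
    hamming K q + 1 ≡⟨ +-comm (hamming K q) 1 ⟩
    suc (hamming K q) ∎
    where
    open ≡-Reasoning
    𝟙-xor-∨ : ∀ x c y → (c ≡ true → x ≡ false × y ≡ true) → 𝟙 (x xor y) ≡ 𝟙 ((x ∨ c) xor y) + 𝟙 c
    𝟙-xor-∨ x false y _ = trans (cong (λ z → 𝟙 (z xor y)) (sym (∨-identityʳ x))) (sym (+-identityʳ _))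
    𝟙-xor-∨ x true y new with new refl
    ... | refl , refl = refl
    split : ∀ i j → 𝟙 (entry m i j xor entry q i j) ≡ 𝟙 (entry K i j xor entry q i j) + 𝟙 (isCell i j)
    split i j = trans (𝟙-xor-∨ (entry m i j) (isCell i j) (entry q i j) new)
                      (cong (λ z → 𝟙 (z xor entry q i j) + 𝟙 (isCell i j)) (sym (entry-K i j)))
      where
      new : isCell i j ≡ true → entry m i j ≡ false × entry q i j ≡ true
      new e with isCell⇒≡ {i} {j} e
      ... | refl , refl = proj₂ holds , q∋ab

hamming-cover : {A B : Mat n} → Covers A B → hamming A B ≡ 1
hamming-cover {A = A} {B} (A-ideal , B-ideal , (A⊆B , B⊈A) , maximal) with B ⊆? A
... | inj₁ B⊆A = ⊥-elim (B⊈A (⊆ℕ⇒⊆ {A = B} {A} B⊆A))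
... | inj₂ least = viaExtension
  where
  open OneCellExtension (IsIdeal⇒IsIdealℕ {M = A} A-ideal) (IsIdeal⇒IsIdealℕ {M = B} B-ideal)
                        (⊆⇒⊆ℕ {A = A} {B} A⊆B) least
  viaExtension : hamming A B ≡ 1
  viaExtension with B ⊆? K
  ... | inj₁ B⊆K = trans (hamming-K {B} p∋ab)
    (cong suc (trans (cong (λ X → hamming X B) (⊆-antisym {A = K} {B} K⊆p B⊆K)) (hamming-self B)))
  ... | inj₂ B∖K = ⊥-elim (maximal K (IsIdealℕ⇒IsIdeal K-ideal) m⊂K
                     (⊆ℕ⇒⊆ {A = K} {B} K⊆p , λ B⊆K → LexLeast⇒⊈ {A = B} {K} B∖K (⊆⇒⊆ℕ {A = B} {K} B⊆K)))

hamming-adjacent : {A B : Mat n} → Adj A B → hamming A B ≡ 1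
hamming-adjacent {A = A} {B} (inj₁ A⋖B) = hamming-cover {A = A} {B} A⋖B
hamming-adjacent {A = A} {B} (inj₂ B⋖A) = trans (hamming-comm A B) (hamming-cover {A = B} {A} B⋖A)

hamming≤walk : {A B : Mat n} {k : ℕ} → Walk A B k → hamming A B ≤ k
hamming≤walk {A = A} here = ≤-reflexive (hamming-self A)
hamming≤walk {A = X} {Z} (step {q = Y} X~Y walk) = begin
  hamming X Z ≤⟨ hamming-triangle X Y Z ⟩
  hamming X Y + hamming Y Z ≡⟨ cong (_+ hamming Y Z) (hamming-adjacent {A = X} {Y} X~Y) ⟩
  suc (hamming Y Z) ≤⟨ s≤s (hamming≤walk walk) ⟩
  suc _ ∎
  where open ≤-Reasoning

_++ʷ_ : {X Y Z : Mat n} {k l : ℕ} → Walk X Y k → Walk Y Z l → Walk X Z (k + l)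
here ++ʷ w = w
step a v ++ʷ w = step a (v ++ʷ w)

reverseʷ : {A B : Mat n} {k : ℕ} → Walk A B k → Walk B A k
reverseʷ here = here
reverseʷ (step {k = k} a w) = subst (Walk _ _) (+-comm k 1) (reverseʷ w ++ʷ step (swap a) here)

upwardWalk : ∀ d {m p : Mat n} → IsIdealℕ m → IsIdealℕ p → m ⊆ℕ p → hamming m p ≡ d → Walk m p d
upwardWalk d {m} {p} m-ideal p-ideal m⊆p dist with p ⊆? m
... | inj₁ p⊆m with ⊆-antisym {A = m} {p} m⊆p p⊆m
...   | refl = subst (Walk m m) (trans (sym (hamming-self m)) dist) here
upwardWalk d {m} {p} m-ideal p-ideal m⊆p dist | inj₂ least = climb d dist
  where
  open OneCellExtension m-ideal p-ideal m⊆p least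
  climb : ∀ d → hamming m p ≡ d → Walk m p d
  climb zero dist = ⊥-elim (1+n≢0 (trans (sym (hamming-K {p} p∋ab)) dist))
  climb (suc d) dist =
    step (inj₁ m⋖K) (upwardWalk d K-ideal p-ideal K⊆p (suc-injective (trans (sym (hamming-K {p} p∋ab)) dist)))

meet : Mat n → Mat n → Mat n
meet {n} A B = fromEntries n (λ i j → entry A i j ∧ entry B i j)

module _ {A B : Mat n} where

  entry-meet : ∀ i j → entry (meet A B) i j ≡ entry A i j ∧ entry B i j
  entry-meet = entry-fromEntries _ (λ {i} {j} e → entry-true⇒< A (∧-conicalˡ (entry A i j) _ e))

  meet⊆ˡ : meet A B ⊆ℕ A
  meet⊆ˡ {i} {j} e = ∧-conicalˡ (entry A i j) _ (trans (sym (entry-meet i j)) e)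

  meet⊆ʳ : meet A B ⊆ℕ B
  meet⊆ʳ {i} {j} e = ∧-conicalʳ (entry A i j) _ (trans (sym (entry-meet i j)) e)

  meet-ideal : IsIdealℕ A → IsIdealℕ B → IsIdealℕ (meet A B)
  meet-ideal A-ideal B-ideal = record
    { staircase = λ e → A.staircase (meet⊆ˡ e)
    ; downClosed = λ {_} {_} {i′} {j′} e i′≤j′ i′≤i j′≤j → trans (entry-meet i′ j′)
        (cong₂ _∧_ (A.downClosed (meet⊆ˡ e) i′≤j′ i′≤i j′≤j) (B.downClosed (meet⊆ʳ e) i′≤j′ i′≤i j′≤j)) }
    where
    module A = IsIdealℕ A-ideal
    module B = IsIdealℕ B-ideal

  hamming-meet : hamming A B ≡ hamming (meet A B) A + hamming (meet A B) B
  hamming-meet = trans (∑□-cong n (λ {i} {j} _ _ → trans (split (entry A i j) (entry B i j))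
      (cong (λ z → 𝟙 (z xor entry A i j) + 𝟙 (z xor entry B i j)) (sym (entry-meet i j))))) (∑□-+ n _ _)
    where
    split : ∀ x y → 𝟙 (x xor y) ≡ 𝟙 ((x ∧ y) xor x) + 𝟙 ((x ∧ y) xor y)
    split false y = refl
    split true false = refl
    split true true = refl

hamming-isDist : {p q : Mat n} → IsIdeal p → IsIdeal q → IsDist p q (hamming p q)
hamming-isDist {p = p} {q} p-ideal q-ideal =
  subst (Walk p q) (sym (hamming-meet {A = p} {q}))
    (reverseʷ (upwardWalk _ p⊓q-ideal (IsIdeal⇒IsIdealℕ {M = p} p-ideal) (meet⊆ˡ {A = p} {q}) refl) ++ʷ
     upwardWalk _ p⊓q-ideal (IsIdeal⇒IsIdealℕ {M = q} q-ideal) (meet⊆ʳ {A = p} {q}) refl) ,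
  λ _ → hamming≤walk
  where
  p⊓q-ideal = meet-ideal (IsIdeal⇒IsIdealℕ {M = p} p-ideal) (IsIdeal⇒IsIdealℕ {M = q} q-ideal)

-- Ideals as bit strings, via their diagonal lengths

downset≡prefix : ∀ n (P : ℕ → Bool) → (∀ {i i′} → P i ≡ true → i′ ≤ i → P i′ ≡ true) →
  (∀ {i} → P i ≡ true → i < n) → ∀ i → P i ≡ does (i <? ∑[ i < n ] 𝟙 (P i))
downset≡prefix zero P _ bounded i = ¬-not (λ Pi → n≮0 (bounded Pi))
downset≡prefix (suc n) P down bounded i with P 0 in P0
... | false = trans (noneHolds i) (cong (λ s → does (i <? s)) (sym (∑<-zero n (λ {j} _ → cong 𝟙 (noneHolds (suc j))))))
  where
  noneHolds : ∀ j → P j ≡ false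
  noneHolds j = ¬-not (λ Pj → true≢false (trans (sym (down Pj z≤n)) P0))
downset≡prefix (suc n) P down bounded zero | true = P0
downset≡prefix (suc n) P down bounded (suc i) | true =
  downset≡prefix n (P ∘ suc) (λ e i′≤i → down e (s≤s i′≤i)) (s<s⁻¹ ∘ bounded) i

diagonalLength : ℕ → Mat n → ℕ
diagonalLength {n} k M = ∑[ i < n ] 𝟙 (entry M i (i + k))

diagonalLength≤ : ∀ k (M : Mat n) → diagonalLength k M ≤ n
diagonalLength≤ {n} k M = ∑<-𝟙≤ n (λ i → entry M i (i + k))

diagonalLength-≥ : ∀ {k} (M : Mat n) → n ≤ k → diagonalLength k M ≡ 0
diagonalLength-≥ {n} {k} M n≤k = ∑<-zero n (λ {i} _ → cong 𝟙 (entry-≥ M (≤-trans n≤k (m≤n+m k i))))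

module Diagonals {M : Mat n} (M-ideal : IsIdealℕ M) where
  open IsIdealℕ M-ideal

  entry-diagonal : ∀ k i → entry M i (i + k) ≡ does (i <? diagonalLength k M)
  entry-diagonal k = downset≡prefix n (λ i → entry M i (i + k))
    (λ e i′≤i → downClosed e (m≤m+n _ k) i′≤i (+-monoˡ-≤ k i′≤i)) (proj₁ ∘ entry-true⇒< M)

  diagonal⁺ : ∀ {i k} → i < diagonalLength k M → M ∋⟨ i , i + k ⟩
  diagonal⁺ {i} {k} i<r = trans (entry-diagonal k i) (dec-true (i <? _) i<r)

  diagonal⁻ : ∀ {i k} → M ∋⟨ i , i + k ⟩ → i < diagonalLength k M
  diagonal⁻ {i} {k} e = does-true⇒ (i <? _) (trans (sym (entry-diagonal k i)) e)

  diagonalLength-antitone : ∀ k → diagonalLength (suc k) M ≤ diagonalLength k M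
  diagonalLength-antitone k = ≮⇒≥ λ r<r′ →
    <-irrefl refl (diagonal⁻ (downClosed (diagonal⁺ r<r′) (m≤m+n r k) ≤-refl (+-monoʳ-≤ r (n≤1+n k))))
    where r = diagonalLength k M

  diagonalLength-drop≤1 : ∀ k → diagonalLength k M ≤ suc (diagonalLength (suc k) M)
  diagonalLength-drop≤1 k = ≮⇒≥ λ 1+r′<r →
    <-irrefl refl (diagonal⁻ (subst (λ j → M ∋⟨ r′ , j ⟩) (sym (+-suc r′ k))
      (downClosed (diagonal⁺ 1+r′<r) (m≤n⇒m≤1+n (m≤m+n r′ k)) (n≤1+n r′) ≤-refl)))
    where r′ = diagonalLength (suc k) M

  entry-< : ∀ {i j} → j < i → entry M i j ≡ false
  entry-< j<i = ¬-not (λ e → <⇒≱ j<i (staircase e))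

hamming-diagonals : {A B : Mat n} → IsIdealℕ A → IsIdealℕ B →
  hamming A B ≡ ∑[ k < n ] ∣ diagonalLength k A - diagonalLength k B ∣
hamming-diagonals {n} {A} {B} A-ideal B-ideal = begin
  hamming A B
    ≡⟨ ∑<-cong n (λ {i} _ → ∑<-shift i n (λ j → 𝟙 (entry A i j xor entry B i j))
         (λ j<i → cong₂ (λ x y → 𝟙 (x xor y)) (A.entry-< j<i) (B.entry-< j<i))
         (λ n≤i+k → cong₂ (λ x y → 𝟙 (x xor y)) (entry-≥ A n≤i+k) (entry-≥ B n≤i+k))) ⟩
  ∑[ i < n ] ∑[ k < n ] 𝟙 (entry A i (i + k) xor entry B i (i + k))
    ≡⟨ ∑<-cong n (λ {i} _ → ∑<-cong n (λ {k} _ →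
         cong₂ (λ x y → 𝟙 (x xor y)) (A.entry-diagonal k i) (B.entry-diagonal k i))) ⟩
  ∑[ i < n ] ∑[ k < n ] 𝟙 (does (i <? diagonalLength k A) xor does (i <? diagonalLength k B))
    ≡⟨ ∑<-comm n n _ ⟩
  ∑[ k < n ] ∑[ i < n ] 𝟙 (does (i <? diagonalLength k A) xor does (i <? diagonalLength k B))
    ≡⟨ ∑<-cong n (λ {k} _ → ∑<-𝟙-xor n (diagonalLength≤ k A) (diagonalLength≤ k B)) ⟩
  ∑[ k < n ] ∣ diagonalLength k A - diagonalLength k B ∣ ∎
  where
  open ≡-Reasoning
  module A = Diagonals A-ideal
  module B = Diagonals B-ideal

ideal-ext : {A B : Mat n} → IsIdealℕ A → IsIdealℕ B → (∀ k → diagonalLength k A ≡ diagonalLength k B) → A ≡ B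
ideal-ext {A = A} {B} A-ideal B-ideal same = entry-injective A B pointwise
  where
  module A = Diagonals A-ideal
  module B = Diagonals B-ideal
  pointwise : ∀ i j → entry A i j ≡ entry B i j
  pointwise i j with i ≤? j
  ... | no i≰j = trans (A.entry-< (≰⇒> i≰j)) (sym (B.entry-< (≰⇒> i≰j)))
  ... | yes i≤j = begin
    entry A i j ≡⟨ cong (entry A i) (m+[n∸m]≡n i≤j) ⟨
    entry A i (i + (j ∸ i)) ≡⟨ A.entry-diagonal (j ∸ i) i ⟩
    does (i <? diagonalLength (j ∸ i) A) ≡⟨ cong (λ r → does (i <? r)) (same (j ∸ i)) ⟩
    does (i <? diagonalLength (j ∸ i) B) ≡⟨ B.entry-diagonal (j ∸ i) i ⟨
    entry B i (i + (j ∸ i)) ≡⟨ cong (entry B i) (m+[n∸m]≡n i≤j) ⟩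
    entry B i j ∎
    where open ≡-Reasoning

profileIdeal : ∀ n → List Bool → Mat n
profileIdeal n c = fromEntries n (λ i j → does (i ≤? j) ∧ does (i <? suffixWeight (j ∸ i) c))

module _ {c : List Bool} (∣c∣≡n : length c ≡ n) where

  entry-profileIdeal : ∀ i j → entry (profileIdeal n c) i j ≡ does (i ≤? j) ∧ does (i <? suffixWeight (j ∸ i) c)
  entry-profileIdeal = entry-fromEntries _ support
    where
    support : ∀ {i j} → does (i ≤? j) ∧ does (i <? suffixWeight (j ∸ i) c) ≡ true → i < n × j < n
    support {i} {j} e =
      let i≤j = does-true⇒ (i ≤? j) (∧-conicalˡ _ _ e)
          i<w = does-true⇒ (i <? _) (∧-conicalʳ (does (i ≤? j)) _ e)
          j<n = subst (_< n) (m+[n∸m]≡n i≤j)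
                  (≰⇒> (λ n≤ → <⇒≱ i<w (suffixWeight-small c (subst (_≤ i + (j ∸ i)) (sym ∣c∣≡n) n≤))))
      in ≤-<-trans i≤j j<n , j<n

  profileIdeal-ideal : IsIdealℕ (profileIdeal n c)
  profileIdeal-ideal = record { staircase = staircase ; downClosed = downClosed }
    where
    staircase : ∀ {i j} → profileIdeal n c ∋⟨ i , j ⟩ → i ≤ j
    staircase {i} {j} e = does-true⇒ (i ≤? j) (∧-conicalˡ _ _ (trans (sym (entry-profileIdeal i j)) e))
    downClosed : ∀ {i j i′ j′} → profileIdeal n c ∋⟨ i , j ⟩ → i′ ≤ j′ → i′ ≤ i → j′ ≤ j →
                 profileIdeal n c ∋⟨ i′ , j′ ⟩
    downClosed {i} {j} {i′} {j′} e i′≤j′ i′≤i j′≤j = trans (entry-profileIdeal i′ j′)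
      (cong₂ _∧_ (dec-true (i′ ≤? j′) i′≤j′) (dec-true (i′ <? suffixWeight (j′ ∸ i′) c) i′<w))
      where
      e′ = trans (sym (entry-profileIdeal i j)) e
      i≤j = does-true⇒ (i ≤? j) (∧-conicalˡ _ _ e′)
      i<w : i < suffixWeight (j ∸ i) c
      i<w = does-true⇒ (i <? _) (∧-conicalʳ (does (i ≤? j)) _ e′)
      j∸i′ : j ∸ i′ ≡ (j ∸ i) + (i ∸ i′)
      j∸i′ = trans (cong (_∸ i′) (sym (m∸n+n≡m i≤j))) (+-∸-assoc (j ∸ i) i′≤i)
      i′<w′ : i′ < suffixWeight (j ∸ i′) c
      i′<w′ = +-cancelʳ-< (i ∸ i′) i′ _ (begin-strict
        i′ + (i ∸ i′) ≡⟨ m+[n∸m]≡n i′≤i ⟩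
        i <⟨ i<w ⟩
        suffixWeight (j ∸ i) c ≤⟨ suffixWeight-Lipschitz c (j ∸ i) (i ∸ i′) ⟩
        suffixWeight ((j ∸ i) + (i ∸ i′)) c + (i ∸ i′) ≡⟨ cong (λ x → suffixWeight x c + (i ∸ i′)) j∸i′ ⟨
        suffixWeight (j ∸ i′) c + (i ∸ i′) ∎)
        where open ≤-Reasoning
      i′<w : i′ < suffixWeight (j′ ∸ i′) c
      i′<w = <-≤-trans i′<w′ (suffixWeight-antitone c (∸-monoˡ-≤ i′ j′≤j))

  profileIdeal-diagonal : ∀ k → diagonalLength k (profileIdeal n c) ≡ suffixWeight k c
  profileIdeal-diagonal k = begin
    ∑[ i < n ] 𝟙 (entry (profileIdeal n c) i (i + k)) ≡⟨ ∑<-cong n (λ {i} _ → cong 𝟙 (diagonalEntry i)) ⟩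
    ∑[ i < n ] 𝟙 (does (i <? suffixWeight k c))
      ≡⟨ ∑<-𝟙< n (≤-trans (suffixWeight≤ k c) (≤-trans (m∸n≤m _ k) (≤-reflexive ∣c∣≡n))) ⟩
    suffixWeight k c ∎
    where
    open ≡-Reasoning
    diagonalEntry : ∀ i → entry (profileIdeal n c) i (i + k) ≡ does (i <? suffixWeight k c)
    diagonalEntry i = trans (entry-profileIdeal i (i + k))
      (cong₂ (λ b x → b ∧ does (i <? suffixWeight x c)) (dec-true (i ≤? i + k) (m≤m+n i k)) (m+n∸m≡n i k))

profileIdeal-injective : ∀ {c c′} → length c ≡ n → length c′ ≡ n → profileIdeal n c ≡ profileIdeal n c′ → c ≡ c′
profileIdeal-injective ∣c∣≡n ∣c′∣≡n same = suffixWeight-injective (trans ∣c∣≡n (sym ∣c′∣≡n))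
  (λ k → trans (sym (profileIdeal-diagonal ∣c∣≡n k)) (trans (cong (diagonalLength k) same) (profileIdeal-diagonal ∣c′∣≡n k)))

hamming-profileIdeal : ∀ {c c′} → length c ≡ n → length c′ ≡ n →
  hamming (profileIdeal n c) (profileIdeal n c′) ≡ profileDistance n c c′
hamming-profileIdeal {n} ∣c∣≡n ∣c′∣≡n = trans (hamming-diagonals (profileIdeal-ideal ∣c∣≡n) (profileIdeal-ideal ∣c′∣≡n))
  (∑<-cong n (λ {k} _ → cong₂ ∣_-_∣ (profileIdeal-diagonal ∣c∣≡n k) (profileIdeal-diagonal ∣c′∣≡n k)))

𝟙-<-step : ∀ {x y} → y ≤ x → x ≤ suc y → 𝟙 (does (y <? x)) + y ≡ x
𝟙-<-step {x} {y} y≤x x≤1+y with m≤n⇒m<n∨m≡n y≤x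
... | inj₁ y<x = trans (cong (λ b → 𝟙 b + y) (dec-true (y <? x) y<x)) (≤-antisym y<x x≤1+y)
... | inj₂ refl = cong (λ b → 𝟙 b + y) (dec-false (y <? y) (<-irrefl refl))

diagonalProfile : Mat n → List Bool
diagonalProfile {n} M = applyUpTo (λ k → does (diagonalLength (suc k) M <? diagonalLength k M)) n

length-diagonalProfile : (M : Mat n) → length (diagonalProfile M) ≡ n
length-diagonalProfile {n} M = length-applyUpTo _ n

module _ {M : Mat n} (M-ideal : IsIdealℕ M) where
  open Diagonals M-ideal

  suffixWeight-diagonalProfile : ∀ k → suffixWeight k (diagonalProfile M) ≡ diagonalLength k M
  suffixWeight-diagonalProfile k = begin
    weight (drop k (applyUpTo descends n)) ≡⟨ cong weight (drop-applyUpTo k n descends) ⟩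
    weight (applyUpTo (descends ∘ (k +_)) (n ∸ k)) ≡⟨ weight-applyUpTo (n ∸ k) _ ⟩
    ∑[ t < n ∸ k ] 𝟙 (descends (k + t)) ≡⟨ +-identityʳ _ ⟨
    ∑[ t < n ∸ k ] 𝟙 (descends (k + t)) + 0
      ≡⟨ cong (∑[ t < n ∸ k ] 𝟙 (descends (k + t)) +_) (diagonalLength-≥ M (m≤n+m∸n n k)) ⟨
    ∑[ t < n ∸ k ] 𝟙 (descends (k + t)) + r (k + (n ∸ k)) ≡⟨ ∑<-telescope (n ∸ k) _ (λ t → r (k + t)) R-step ⟩
    r (k + 0) ≡⟨ cong r (+-identityʳ k) ⟩
    r k ∎
    where
    open ≡-Reasoning
    r : ℕ → ℕ
    r k = diagonalLength k M
    descends : ℕ → Bool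
    descends k = does (r (suc k) <? r k)
    R-step : ∀ t → 𝟙 (descends (k + t)) + r (k + suc t) ≡ r (k + t)
    R-step t rewrite +-suc k t = 𝟙-<-step (diagonalLength-antitone (k + t)) (diagonalLength-drop≤1 (k + t))

  profileIdeal-diagonalProfile : profileIdeal n (diagonalProfile M) ≡ M
  profileIdeal-diagonalProfile = ideal-ext (profileIdeal-ideal (length-diagonalProfile M)) M-ideal
    (λ k → trans (profileIdeal-diagonal (length-diagonalProfile M) k) (suffixWeight-diagonalProfile k))

map⁺-injectiveOn : (f : A → B) {xs : List A} → (∀ {x y} → x ∈ xs → y ∈ xs → f x ≡ f y → x ≡ y) →
  Unique xs → Unique (map f xs)
map⁺-injectiveOn f {[]} _ [] = []
map⁺-injectiveOn f {x ∷ xs} injective (x∉xs ∷ xs!) =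
  All.map⁺ (All.tabulate (λ y∈xs fx≡fy → All.lookup x∉xs y∈xs (injective (here refl) (there y∈xs) fx≡fy))) ∷
  map⁺-injectiveOn f (λ x∈ y∈ → injective (there x∈) (there y∈)) xs!

unique-⇔⇒↭ : {xs ys : List A} → Unique xs → Unique ys → (∀ {x} → x ∈ xs ⇔ x ∈ ys) → xs ↭ ys
unique-⇔⇒↭ xs! ys! same = ∼bag⇒↭ (unique∧set⇒bag xs! ys! same)

wiener-↭ : {xs ys : List A} (d : A → A → ℕ) → xs ↭ ys → wiener xs d ≡ wiener ys d
wiener-↭ {xs = xs} {ys} d xs↭ys =
  trans (∑-↭ (λ p → ∑ xs (d p)) xs↭ys) (∑-cong ys (λ p → ∑-↭ (d p) xs↭ys))

profileIdeals : ∀ n → List (Mat n)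
profileIdeals n = map (profileIdeal n) (bitStrings n)

∈-profileIdeals⇔ : ∀ {n} (M : Mat n) → M ∈ profileIdeals n ⇔ IsIdeal M
∈-profileIdeals⇔ {n} M = mk⇔ ideal profile
  where
  ideal : M ∈ profileIdeals n → IsIdeal M
  ideal M∈ with ∈-map⁻ (profileIdeal n) M∈
  ... | _ , c∈ , refl = IsIdealℕ⇒IsIdeal (profileIdeal-ideal (∈-bitStrings⁻ n c∈))
  profile : IsIdeal M → M ∈ profileIdeals n
  profile M-ideal = subst (_∈ profileIdeals n) (profileIdeal-diagonalProfile (IsIdeal⇒IsIdealℕ M-ideal))
    (∈-map⁺ (profileIdeal n) (subst (λ m → diagonalProfile M ∈ bitStrings m) (length-diagonalProfile M) (∈-bitStrings⁺ _)))

profileIdeals-unique : ∀ n → Unique (profileIdeals n)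
profileIdeals-unique n = map⁺-injectiveOn (profileIdeal n)
  (λ c∈ c′∈ → profileIdeal-injective (∈-bitStrings⁻ n c∈) (∈-bitStrings⁻ n c′∈)) (bitStrings-unique n)

wiener-profileIdeals : ∀ n → wiener (profileIdeals n) hamming ≡ totalProfileDistance n
wiener-profileIdeals n = begin
  ∑[ p ∈ profileIdeals n ] ∑ (profileIdeals n) (hamming p) ≡⟨ ∑-map (profileIdeal n) (bitStrings n) _ ⟩
  ∑[ c ∈ bitStrings n ] ∑ (profileIdeals n) (hamming (profileIdeal n c))
    ≡⟨ ∑-cong (bitStrings n) (λ c → ∑-map (profileIdeal n) (bitStrings n) _) ⟩
  pairSum n (λ c c′ → hamming (profileIdeal n c) (profileIdeal n c′)) ≡⟨ pairSum-cong n (λ c c′ → hamming-profileIdeal) ⟩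
  totalProfileDistance n ∎
  where open ≡-Reasoning

corollary1p8 : ∀ (n : ℕ) → 1 ≤ n →
    (vs : List (Mat n)) → Unique vs → (∀ (M : Mat n) → (M ∈ vs) ⇔ IsIdeal M) →
    Σ (Mat n → Mat n → ℕ) (λ dist →
      (∀ p q → p ∈ vs → q ∈ vs → IsDist p q (dist p q)) ×
      (3 * wiener vs dist ≡ (2 * n) * (2 * n + 1) * ((2 * n ∸ 1) C n)))
corollary1p8 n _ vs vs! vs⇔ideal = hamming , distance , wienerIndex
  where
  distance : ∀ p q → p ∈ vs → q ∈ vs → IsDist p q (hamming p q)
  distance p q p∈ q∈ = hamming-isDist (Equivalence.to (vs⇔ideal p) p∈) (Equivalence.to (vs⇔ideal q) q∈)
  vs↭ideals : vs ↭ profileIdeals n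
  vs↭ideals = unique-⇔⇒↭ vs! (profileIdeals-unique n) (λ {M} → ⇔.trans (vs⇔ideal M) (⇔.sym (∈-profileIdeals⇔ M)))
  wienerIndex : 3 * wiener vs hamming ≡ (2 * n) * (2 * n + 1) * ((2 * n ∸ 1) C n)
  wienerIndex = begin
    3 * wiener vs hamming ≡⟨ cong (3 *_) (trans (wiener-↭ hamming vs↭ideals) (wiener-profileIdeals n)) ⟩
    3 * totalProfileDistance n ≡⟨ 3*totalProfileDistance≡n*[1+2n]*[2n]Cn n ⟩
    n * suc (n + n) * ((n + n) C n) ≡⟨ n*[1+2n]*[2n]Cn≡2n*[2n+1]*[2n∸1]Cn n ⟩
    (2 * n) * (2 * n + 1) * ((2 * n ∸ 1) C n) ∎
    where open ≡-Reasoning
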